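{- Let $\mathfrak A$ be a structure, $\mathfrak B$ a substructure of $\mathfrak A$ and $\varphi$ a sentence of $\mathcal{POC}[\mathcal{QF}]$. If $\mathfrak A\models\varphi$ then $\mathfrak B\models\varphi$.
   Context: Structures are over a relational vocabulary. Variables: first-order $x,y,\dots$ and Boolean $\alpha,\beta,\dots$ ranging over $\{\perp,\top\}$. For tuples $\vec x_i=(x_{i1},\dots,x_{in_i})$ ($1\le i\le m$) of first-order variables (repetitions allowed) and distinct Boolean variables $\alpha_1,\dots,\alpha_m$, the connective $N_\pi\vec x_1\alpha_1\dots\vec x_m\alpha_m$ has pattern $\pi=(n_1,\dots,n_m,E)$, $E=\{(i,j,k,l):x_{ij}=x_{kl}\}$, and $\mathfrak A,s\models N_\pi\vec x_1\alpha_1\dots\vec x_m\alpha_m\varphi$ iff there are $f_i:A^{n_i}\to\{\perp,\top\}$ such that for all $\vec a_i\in A^{n_i}$ with $a_{ij}=a_{kl}$ whenever $(i,j,k,l)\in E$, $\mathfrak A,s(\vec a_1/\vec x_1,\dots,\vec a_m/\vec x_m,f_1(\vec a_1)/\alpha_1,\dots,f_m(\vec a_m)/\alpha_m)\models\varphi$. $\mathcal{POC}[\mathcal{QF}]$ consists of the formulas $N_\pi\vec x_1\alpha_1\dots\vec x_m\alpha_m\varphi$ with $\varphi$ a quantifier-free formula built from literals $\alpha,\neg\alpha$ ($\alpha$ true iff $s(\alpha)=\top$), (negated) equalities and (negated) relational atoms with $\wedge,\vee$ (classical semantics). A sentence has no free variables. -}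

module Defs where

open import Data.Nat using (ℕ)
open import Data.Fin using (Fin)
open import Data.Bool using (Bool; true; false)
open import Data.Product using (Σ; _×_)
open import Data.Sum using (_⊎_)
open import Relation.Nullary using (¬_)
open import Relation.Binary.PropositionalEquality using (_≡_; _≢_)
open import Function using (_∘_)
open import Function.Definitions using (Injective)

record Vocab : Set₁ where
  field
    Sym : Set
    ar  : Sym → ℕ

open Vocab public

record Structure (τ : Vocab) : Set₁ where
  field
    Carrier : Set
    relᴬ    : (R : Sym τ) → (Fin (ar τ R) → Carrier) → Set

open Structure public

-- 𝔅 is a substructure of 𝔄 (up to identification along an injective map):
-- the domain of 𝔅 is (identified with) a subset of that of 𝔄 and the relations
-- of 𝔅 are the restrictions of those of 𝔄.
record Substructure {τ : Vocab} (𝔅 𝔄 : Structure τ) : Set where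
  field
    inc      : Carrier 𝔅 → Carrier 𝔄
    inc-inj  : Injective _≡_ _≡_ inc
    rel-to   : ∀ (R : Sym τ) (bs : Fin (ar τ R) → Carrier 𝔅) →
               relᴬ 𝔅 R bs → relᴬ 𝔄 R (inc ∘ bs)
    rel-from : ∀ (R : Sym τ) (bs : Fin (ar τ R) → Carrier 𝔅) →
               relᴬ 𝔄 R (inc ∘ bs) → relᴬ 𝔅 R bs

-- Variables: first-order variables and Boolean variables are both named by ℕ
-- (two separate sorts).

data QF (τ : Vocab) : Set where
  bvar  : ℕ → QF τ
  nbvar : ℕ → QF τ
  eq    : ℕ → ℕ → QF τ
  neq   : ℕ → ℕ → QF τ
  rel   : (R : Sym τ) → (Fin (ar τ R) → ℕ) → QF τ
  nrel  : (R : Sym τ) → (Fin (ar τ R) → ℕ) → QF τ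
  _∧_   : QF τ → QF τ → QF τ
  _∨_   : QF τ → QF τ → QF τ

data OccFO {τ : Vocab} (v : ℕ) : QF τ → Set where
  eqˡ   : ∀ w → OccFO v (eq v w)
  eqʳ   : ∀ w → OccFO v (eq w v)
  neqˡ  : ∀ w → OccFO v (neq v w)
  neqʳ  : ∀ w → OccFO v (neq w v)
  inrel  : ∀ R xs (j : Fin (ar τ R)) → xs j ≡ v → OccFO v (rel R xs)
  innrel : ∀ R xs (j : Fin (ar τ R)) → xs j ≡ v → OccFO v (nrel R xs)
  ∧ˡ : ∀ {φ} ψ → OccFO v φ → OccFO v (φ ∧ ψ)
  ∧ʳ : ∀ φ {ψ} → OccFO v ψ → OccFO v (φ ∧ ψ)
  ∨ˡ : ∀ {φ} ψ → OccFO v φ → OccFO v (φ ∨ ψ)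
  ∨ʳ : ∀ φ {ψ} → OccFO v ψ → OccFO v (φ ∨ ψ)

data OccB {τ : Vocab} (b : ℕ) : QF τ → Set where
  pos : OccB b (bvar b)
  neg : OccB b (nbvar b)
  ∧ˡ : ∀ {φ} ψ → OccB b φ → OccB b (φ ∧ ψ)
  ∧ʳ : ∀ φ {ψ} → OccB b ψ → OccB b (φ ∧ ψ)
  ∨ˡ : ∀ {φ} ψ → OccB b φ → OccB b (φ ∨ ψ)
  ∨ʳ : ∀ φ {ψ} → OccB b ψ → OccB b (φ ∨ ψ)

SatQF : {τ : Vocab} (𝔄 : Structure τ) → (ℕ → Carrier 𝔄) → (ℕ → Bool) → QF τ → Set
SatQF 𝔄 s t (bvar b)    = t b ≡ true
SatQF 𝔄 s t (nbvar b)   = t b ≡ false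
SatQF 𝔄 s t (eq x y)    = s x ≡ s y
SatQF 𝔄 s t (neq x y)   = ¬ (s x ≡ s y)
SatQF 𝔄 s t (rel R xs)  = relᴬ 𝔄 R (s ∘ xs)
SatQF 𝔄 s t (nrel R xs) = ¬ relᴬ 𝔄 R (s ∘ xs)
SatQF 𝔄 s t (φ ∧ ψ)     = SatQF 𝔄 s t φ × SatQF 𝔄 s t ψ
SatQF 𝔄 s t (φ ∨ ψ)     = SatQF 𝔄 s t φ ⊎ SatQF 𝔄 s t ψ

-- A POC[QF] formula  N_π x⃗₁ α₁ … x⃗ₘ αₘ φ.  The pattern π = (n₁,…,nₘ,E) is
-- determined by n and x (E = {(i,j,k,l) : x i j = x k l}).
record POC (τ : Vocab) : Set where
  field
    m     : ℕ
    n     : Fin m → ℕ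
    x     : (i : Fin m) → Fin (n i) → ℕ      -- repetitions allowed
    α     : Fin m → ℕ
    α-inj : Injective _≡_ _≡_ α
    body  : QF τ

open POC public

UpdFO : {A : Set} {τ : Vocab} (ψ : POC τ) → (ℕ → A) →
        ((i : Fin (m ψ)) → Fin (n ψ i) → A) → (ℕ → A) → Set
UpdFO ψ s a s' =
  (∀ i j → s' (x ψ i j) ≡ a i j) ×
  (∀ v → (∀ i j → x ψ i j ≢ v) → s' v ≡ s v)

UpdB : {τ : Vocab} (ψ : POC τ) → (ℕ → Bool) → (Fin (m ψ) → Bool) → (ℕ → Bool) → Set
UpdB ψ t bs t' =
  (∀ i → t' (α ψ i) ≡ bs i) ×
  (∀ b → (∀ i → α ψ i ≢ b) → t' b ≡ t b)

SatPOC : {τ : Vocab} (𝔄 : Structure τ) → (ℕ → Carrier 𝔄) → (ℕ → Bool) → POC τ → Set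
SatPOC 𝔄 s t ψ =
  Σ ((i : Fin (m ψ)) → (Fin (n ψ i) → Carrier 𝔄) → Bool) λ f →
    ∀ (a : (i : Fin (m ψ)) → Fin (n ψ i) → Carrier 𝔄) →
      (∀ i j k l → x ψ i j ≡ x ψ k l → a i j ≡ a k l) →
      ∀ s' t' → UpdFO ψ s a s' → UpdB ψ t (λ i → f i (a i)) t' →
      SatQF 𝔄 s' t' (body ψ)

IsSentence : {τ : Vocab} → POC τ → Set
IsSentence ψ =
  (∀ v → OccFO v (body ψ) → Σ (Fin (m ψ)) λ i → Σ (Fin (n ψ i)) λ j → x ψ i j ≡ v) ×
  (∀ b → OccB b (body ψ) → Σ (Fin (m ψ)) λ i → α ψ i ≡ b)

-- 𝔄 ⊨ ψ for a sentence: satisfied under every assignment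
-- (for a sentence this does not depend on the assignment).
_⊨_ : {τ : Vocab} → Structure τ → POC τ → Set
𝔄 ⊨ ψ = ∀ (s : ℕ → Carrier 𝔄) (t : ℕ → Bool) → SatPOC 𝔄 s t ψ

-- Quantifier-free formulas are reflected along the embedding inc : B → A.
-- Given Boolean choice functions fᵢ witnessing A ⊨ N_π x⃗₁α₁…x⃗ₘαₘ φ, the
-- functions a⃗ ↦ fᵢ (inc ∘ a⃗) witness it in B: every admissible B-assignment
-- is sent by inc to an admissible A-assignment with the same Boolean values,
-- where φ holds, so φ holds back in B.
module Submission where

open import Defs
open import Data.Nat using (ℕ)
open import Data.Fin using (Fin)
open import Data.Bool using (Bool)
open import Data.Product using (_,_)
open import Data.Sum using (inj₁; inj₂)
open import Relation.Binary.PropositionalEquality using (cong)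
open import Function using (_∘_)

UpdFO-map : ∀ {A B : Set} {τ : Vocab} (ψ : POC τ) (g : A → B)
  {s s' : ℕ → A} {a : (i : Fin (m ψ)) → Fin (n ψ i) → A} →
  UpdFO ψ s a s' → UpdFO ψ (g ∘ s) (λ i j → g (a i j)) (g ∘ s')
UpdFO-map ψ g (upd-x , upd-rest) =
  (λ i j → cong g (upd-x i j)) , (λ v v∉x → cong g (upd-rest v v∉x))

module _ {τ : Vocab} {𝔄 𝔅 : Structure τ} (S : Substructure 𝔅 𝔄) where
  open Substructure S

  SatQF-reflect : ∀ (s : ℕ → Carrier 𝔅) (t : ℕ → Bool) (φ : QF τ) →
    SatQF 𝔄 (inc ∘ s) t φ → SatQF 𝔅 s t φ
  SatQF-reflect s t (bvar b)    h         = h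
  SatQF-reflect s t (nbvar b)   h         = h
  SatQF-reflect s t (eq x y)    h         = inc-inj h
  SatQF-reflect s t (neq x y)   h e       = h (cong inc e)
  SatQF-reflect s t (rel R xs)  h         = rel-from R (s ∘ xs) h
  SatQF-reflect s t (nrel R xs) h r       = h (rel-to R (s ∘ xs) r)
  SatQF-reflect s t (φ ∧ ψ)     (h₁ , h₂) = SatQF-reflect s t φ h₁ , SatQF-reflect s t ψ h₂
  SatQF-reflect s t (φ ∨ ψ)     (inj₁ h)  = inj₁ (SatQF-reflect s t φ h)
  SatQF-reflect s t (φ ∨ ψ)     (inj₂ h)  = inj₂ (SatQF-reflect s t ψ h)

  SatPOC-reflect : ∀ (s : ℕ → Carrier 𝔅) (t : ℕ → Bool) (ψ : POC τ) →
    SatPOC 𝔄 (inc ∘ s) t ψ → SatPOC 𝔅 s t ψ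
  SatPOC-reflect s t ψ (f , f-wins) =
    (λ i a → f i (inc ∘ a)) ,
    λ a a-respects s' t' upd-s upd-t →
      SatQF-reflect s' t' (body ψ)
        (f-wins (λ i j → inc (a i j))
                (λ i j k l e → cong inc (a-respects i j k l e))
                (inc ∘ s') t' (UpdFO-map ψ inc upd-s) upd-t)

lemma7p1 : {τ : Vocab} (𝔄 𝔅 : Structure τ) → Substructure 𝔅 𝔄 →
    (ψ : POC τ) → IsSentence ψ → 𝔄 ⊨ ψ → 𝔅 ⊨ ψ
lemma7p1 𝔄 𝔅 S ψ _ 𝔄⊨ψ s t = SatPOC-reflect S s t ψ (𝔄⊨ψ (inc S ∘ s) t)
  where open Substructure using (inc)
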